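{- Let $\mathcal P$ be the set of all integer partitions (including the empty partition $\emptyset$) and let $F\colon\mathcal P\to\mathbb C$ be arbitrary. Then, as formal power series in $q$, \[\langle F\rangle_q=\sum_{\lambda\in\mathcal P}f(\lambda)q^{|\lambda|},\qquad\text{where}\quad f(\lambda)=\sum_{\delta\mid\lambda}F(\delta)\,\mu_{\mathcal P}(\lambda/\delta).\]
   Context: For a partition $\lambda$, $|\lambda|$ is the sum of its parts and $\ell(\lambda)$ its number of parts. A partition $\delta$ divides $\lambda$ (written $\delta\mid\lambda$) if every part of $\delta$ is a part of $\lambda$, counted with multiplicity (so $\emptyset$ and $\lambda$ divide $\lambda$); in that case $\lambda/\delta$ is the partition obtained by deleting the parts of $\delta$ from $\lambda$. The partition M\"obius function is $\mu_{\mathcal P}(\emptyset)=1$, $\mu_{\mathcal P}(\lambda)=0$ if $\lambda$ has a repeated part, and $\mu_{\mathcal P}(\lambda)=(-1)^{\ell(\lambda)}$ otherwise. The $q$-bracket of $F$ is the formal power series $\langle F\rangle_q:=(q;q)_\infty\sum_{\lambda\in\mathcal P}F(\lambda)q^{|\lambda|}$, where $(q;q)_\infty=\prod_{n\ge1}(1-q^n)$; a series $\sum_{\lambda}f(\lambda)q^{|\lambda|}$ means the power series whose coefficient of $q^n$ is $\sum_{|\lambda|=n}f(\lambda)$. -}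

module Defs where

open import Level using (Level)
open import Algebra.Bundles using (CommutativeRing)
open import Data.Nat using (ℕ; zero; suc; _∸_; _⊓_; _≤_; _≤?_)
open import Data.Nat.Properties using (_≟_)
open import Data.List using (List; []; _∷_; [_]; map; concatMap; applyUpTo; foldr; filter; length; replicate; _++_)
open import Data.List.Relation.Unary.All using (All; all?)
open import Data.List.Relation.Unary.Unique.Propositional using (Unique)
open import Data.List.Relation.Unary.Unique.DecPropositional _≟_ using (unique?)
open import Relation.Nullary using (Dec; yes; no)

-- Integer partitions, represented as weakly decreasing lists of
-- positive natural numbers (e.g. 3+1+1 is 3 ∷ 1 ∷ 1 ∷ []).

size : List ℕ → ℕ
size = foldr Data.Nat._+_ 0

ℓ : List ℕ → ℕ
ℓ = length

-- partitionsF fuel n m : all partitions of n with every part ≤ m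
-- (listed once each, as weakly decreasing lists); fuel ≥ n suffices.
partitionsF : ℕ → ℕ → ℕ → List (List ℕ)
partitionsF fuel       zero    m = [ [] ]
partitionsF zero       (suc n) m = []
partitionsF (suc fuel) (suc n) m =
  concatMap (λ k → map (k ∷_) (partitionsF fuel (suc n ∸ k) k))
            (applyUpTo suc (m ⊓ suc n))

partitions : ℕ → List (List ℕ)
partitions n = partitionsF n n n

count : ℕ → List ℕ → ℕ
count x [] = 0
count x (y ∷ ys) with x ≟ y
... | yes _ = suc (count x ys)
... | no  _ = count x ys

Divides : List ℕ → List ℕ → Set
Divides δ lam = All (λ x → count x δ ≤ count x lam) δ

divides? : (δ lam : List ℕ) → Dec (Divides δ lam)
divides? δ lam = all? (λ x → count x δ ≤? count x lam) δ

deleteOne : ℕ → List ℕ → List ℕ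
deleteOne x [] = []
deleteOne x (y ∷ ys) with x ≟ y
... | yes _ = ys
... | no  _ = y ∷ deleteOne x ys

quot : List ℕ → List ℕ → List ℕ
quot lam δ = foldr deleteOne lam δ

divisors : List ℕ → List (List ℕ)
divisors lam = concatMap (λ k → filter (λ δ → divides? δ lam) (partitions k))
                         (applyUpTo (λ i → i) (suc (size lam)))

-- Ring-valued part (ℂ is replaced by an arbitrary commutative ring).

module _ {c ℓ′ : Level} (R : CommutativeRing c ℓ′) where
  open CommutativeRing R

  Σ : List Carrier → Carrier
  Σ = foldr _+_ 0#

  sign : ℕ → Carrier
  sign zero    = 1#
  sign (suc k) = - sign k

  μP : List ℕ → Carrier
  μP lam with unique? lam
  ... | yes _ = sign (ℓ lam)
  ... | no  _ = 0#

  FPS : Set c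
  FPS = ℕ → Carrier

  _⋆_ : FPS → FPS → FPS
  (a ⋆ b) n = Σ (map (λ k → a k * b (n ∸ k)) (applyUpTo (λ i → i) (suc n)))

  -- polynomials as coefficient lists (constant term first)
  addP : List Carrier → List Carrier → List Carrier
  addP []       q        = q
  addP (a ∷ p)  []       = a ∷ p
  addP (a ∷ p)  (b ∷ q)  = (a + b) ∷ addP p q

  mulP : List Carrier → List Carrier → List Carrier
  mulP []      q = []
  mulP (a ∷ p) q = addP (map (a *_) q) (0# ∷ mulP p q)

  coeffP : List Carrier → ℕ → Carrier
  coeffP []      _       = 0#
  coeffP (a ∷ p) zero    = a
  coeffP (a ∷ p) (suc k) = coeffP p k

  oneMinusQ : ℕ → List Carrier
  oneMinusQ m = 1# ∷ (replicate m 0# ++ [ - 1# ])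

  eulerPoly : ℕ → List Carrier
  eulerPoly N = foldr mulP [ 1# ] (applyUpTo oneMinusQ N)

  -- (q;q)_∞ = ∏_{n≥1} (1 - q^n) as a formal power series: its
  -- coefficient of q^k equals that of the finite product up to N = k
  qPoch : FPS
  qPoch k = coeffP (eulerPoly k) k

  seriesP : (List ℕ → Carrier) → FPS
  seriesP g n = Σ (map g (partitions n))

  qBracket : (List ℕ → Carrier) → FPS
  qBracket F = qPoch ⋆ seriesP F

  fOf : (List ℕ → Carrier) → List ℕ → Carrier
  fOf F lam = Σ (map (λ δ → F δ * μP (quot lam δ)) (divisors lam))

module Submission where

-- Write P(n,m) for the partitions of n with parts ≤ m and, for a partition δ,
-- D δ j m = Σ_{λ ∈ P(j,m), δ∣λ} μ_P(λ/δ); so D ∅ j m = Σ_{ν ∈ P(j,m)} μ_P(ν).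
-- (1) Splitting P(n,m+1) by whether the part m+1 occurs, and using that μ_P changes sign
--     when a new part is added and vanishes on repeated parts, Σ_j D δ j (m+1) q^j equals
--     (1 - q^(m+1)) Σ_j D δ j m q^j whenever m+1 is not a part of δ (D-rec).  For δ = ∅
--     this identifies Σ_j D ∅ j m q^j with ∏_{i≤m} (1 - q^i), whence D ∅ k k = [q^k] (q;q)_∞.
-- (2) For every partition δ with parts ≤ m, Σ_j D δ j m q^j = q^|δ| Σ_j D ∅ j m q^j (D-shift):
--     by induction on m and δ, cancelling a largest part m+1 shared by δ and λ, and using (1)
--     when δ has no part m+1.
-- (3) Expanding the Cauchy product ⟨F⟩_q, the q^n coefficient is Σ_{|δ|≤n} F(δ) [q^(n-|δ|)] (q;q)_∞,
--     which by (2) is Σ_δ Σ_{λ ⊢ n, δ∣λ} F(δ) μ_P(λ/δ); exchanging the sums gives Σ_{λ ⊢ n} f(λ).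

open import Defs
open import Level using (Level)
open import Algebra.Bundles using (CommutativeRing)
open import Data.Nat using (ℕ)
open import Data.List using (List)

open import Data.Nat as ℕ using (zero; suc; _∸_; _⊓_; _≤_; _<_; _≤?_; z≤n; s≤s)
open import Data.Nat.Properties as ℕₚ
  using ( _≟_; ≤-refl; ≤-trans; ≤-pred; <⇒≤; ≰⇒>; <⇒≱; ≤∧≢⇒<; n≤1+n; m≤n⇒m≤1+n; +-cancelˡ-≤
        ; m∸n≤m; +-∸-assoc; m+[n∸m]≡n; m∸[m∸n]≡n; n∸n≡0
        ; m≤n⇒m⊓n≡m; m≥n⇒m⊓n≡n; ⊓-idem; m⊓n≤m; m⊓n≤n )
open import Data.List
  using ([]; _∷_; [_]; map; concat; concatMap; applyUpTo; upTo; foldr; filter; length; replicate; _++_)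
open import Data.List.Properties
  using (map-cong-local; length-++; filter-++; filter-accept; filter-reject; applyUpTo-∷ʳ; map-applyUpTo)
open import Data.List.Relation.Unary.All as All using (All; []; _∷_)
open import Data.List.Relation.Unary.All.Properties using (map⁺; concat⁺; applyUpTo⁺₁; applyUpTo⁺₂)
open import Data.List.Relation.Unary.AllPairs using (_∷_)
open import Data.List.Relation.Unary.Unique.Propositional using (Unique)
open import Data.List.Relation.Binary.Permutation.Propositional
  using (_↭_; ↭-refl; ↭-sym; ↭-trans; ↭-prep; ↭-swap; ↭⇒↭ₛ)
open import Data.List.Relation.Binary.Permutation.Propositional.Properties
  using (drop-∷; ↭-length; ++⁺ˡ; filter-↭) renaming (shift to ↭-shift)
open import Data.List.Relation.Unary.Unique.DecPropositional _≟_ using (unique?)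
open import Data.Product using (_×_; _,_; proj₁; proj₂)
open import Data.Sum using (_⊎_; inj₁; inj₂)
open import Data.Empty using (⊥-elim)
open import Data.Maybe using (nothing)
open import Tactic.RingSolver.Core.AlmostCommutativeRing using (fromCommutativeRing)
open import Relation.Nullary using (Dec; yes; no; ¬_)
open import Relation.Binary.PropositionalEquality as ≡ using (_≡_; _≢_; cong; subst; subst₂)
open import Data.List.Relation.Binary.Permutation.Setoid.Properties (≡.setoid ℕ) using (Unique-resp-↭)

data IsPart : ℕ → List ℕ → Set where
  nil  : ∀ {m} → IsPart m []
  cons : ∀ {m d δ} → 1 ≤ d → d ≤ m → IsPart d δ → IsPart m (d ∷ δ)

IsPart⇒All≤ : ∀ {m δ} → IsPart m δ → All (_≤ m) δ
IsPart⇒All≤ nil            = []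
IsPart⇒All≤ (cons _ d≤m p) = d≤m ∷ All.map (λ x≤d → ≤-trans x≤d d≤m) (IsPart⇒All≤ p)

IsPart-mono : ∀ {m m′ δ} → m ≤ m′ → IsPart m δ → IsPart m′ δ
IsPart-mono _    nil             = nil
IsPart-mono m≤m′ (cons 1≤d d≤m p) = cons 1≤d (≤-trans d≤m m≤m′) p

PartitionOf : ℕ → ℕ → List ℕ → Set
PartitionOf m n lam = IsPart m lam × size lam ≡ n

partitionsF-sound : ∀ fuel n m → All (PartitionOf m n) (partitionsF fuel n m)
partitionsF-sound fuel       zero    m = (nil , ≡.refl) ∷ []
partitionsF-sound zero       (suc n) m = []
partitionsF-sound (suc fuel) (suc n) m =
  concat⁺ (map⁺ (applyUpTo⁺₁ suc (m ⊓ suc n) λ {i} i< →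
    map⁺ (All.map (prepend i< ) (partitionsF-sound fuel (n ∸ i) (suc i)))))
  where
  prepend : ∀ {i lam} → i < m ⊓ suc n → PartitionOf (suc i) (n ∸ i) lam →
            PartitionOf m (suc n) (suc i ∷ lam)
  prepend {i} i< (p , size≡) =
    cons (s≤s z≤n) (≤-trans i< (m⊓n≤m m (suc n))) p ,
    ≡.trans (cong (suc i ℕ.+_) size≡) (m+[n∸m]≡n (≤-trans i< (m⊓n≤n m (suc n))))

partitionsF-fuel : ∀ f f′ n m → n ≤ f → n ≤ f′ → partitionsF f n m ≡ partitionsF f′ n m
partitionsF-fuel f        f′        zero    m _       _        = ≡.refl
partitionsF-fuel (suc f) (suc f′) (suc n) m (s≤s n≤f) (s≤s n≤f′) =
  cong concat (map-cong-local (applyUpTo⁺₂ suc (m ⊓ suc n) λ i →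
    cong (map (suc i ∷_)) (partitionsF-fuel f f′ (n ∸ i) (suc i)
      (≤-trans (m∸n≤m n i) n≤f) (≤-trans (m∸n≤m n i) n≤f′))))

P : ℕ → ℕ → List (List ℕ)
P n m = partitionsF n n m

P-sound : ∀ n m → All (PartitionOf m n) (P n m)
P-sound n m = partitionsF-sound n n m

P-saturated : ∀ n m → n ≤ m → P n m ≡ P n n
P-saturated zero    m _   = ≡.refl
P-saturated (suc n) m n≤m =
  cong (λ t → concatMap (λ k → map (k ∷_) (partitionsF n (suc n ∸ k) k)) (applyUpTo suc t))
       (≡.trans (m≥n⇒m⊓n≡n n≤m) (≡.sym (⊓-idem (suc n))))

-- Multiplicities.  count agrees with the library's filter-based count, which transfers
-- invariance under permutation and additivity over concatenation.
count-filter : ∀ x l → count x l ≡ length (filter (x ≟_) l)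
count-filter x []      = ≡.refl
count-filter x (y ∷ l) with x ≟ y
... | yes x≡y = ≡.trans (cong suc (count-filter x l)) (≡.sym (cong length (filter-accept (x ≟_) x≡y)))
... | no  x≢y = ≡.trans (count-filter x l) (≡.sym (cong length (filter-reject (x ≟_) x≢y)))

count-↭ : ∀ x {l l′} → l ↭ l′ → count x l ≡ count x l′
count-↭ x {l} {l′} l↭l′ = begin
  count x l                     ≡⟨ count-filter x l ⟩
  length (filter (x ≟_) l)      ≡⟨ ↭-length (filter-↭ (x ≟_) l↭l′) ⟩
  length (filter (x ≟_) l′)     ≡⟨ ≡.sym (count-filter x l′) ⟩
  count x l′                    ∎
  where open ≡.≡-Reasoning

count-++ : ∀ x l l′ → count x (l ++ l′) ≡ count x l ℕ.+ count x l′
count-++ x l l′ = begin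
  count x (l ++ l′)                                    ≡⟨ count-filter x (l ++ l′) ⟩
  length (filter (x ≟_) (l ++ l′))                     ≡⟨ cong length (filter-++ (x ≟_) l l′) ⟩
  length (filter (x ≟_) l ++ filter (x ≟_) l′)         ≡⟨ length-++ (filter (x ≟_) l) ⟩
  length (filter (x ≟_) l) ℕ.+ length (filter (x ≟_) l′) ≡⟨ ≡.sym (≡.cong₂ ℕ._+_ (count-filter x l) (count-filter x l′)) ⟩
  count x l ℕ.+ count x l′                               ∎
  where open ≡.≡-Reasoning

count-here : ∀ x l → count x (x ∷ l) ≡ suc (count x l)
count-here x l with x ≟ x
... | yes _ = ≡.refl
... | no x≢x = ⊥-elim (x≢x ≡.refl)

count-there : ∀ {x y} l → x ≢ y → count x (y ∷ l) ≡ count x l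
count-there {x} {y} l x≢y with x ≟ y
... | yes x≡y = ⊥-elim (x≢y x≡y)
... | no  _   = ≡.refl

count≡0-or : ∀ {p} {Q : ℕ → Set p} x l → All Q l → count x l ≡ 0 ⊎ Q x
count≡0-or x []      []       = inj₁ ≡.refl
count≡0-or x (y ∷ l) (q ∷ qs) with x ≟ y
... | yes ≡.refl = inj₂ q
... | no  _    = count≡0-or x l qs

count-above : ∀ {m} x l → All (_≤ m) l → m < x → count x l ≡ 0
count-above x l l≤m m<x with count≡0-or x l l≤m
... | inj₁ c≡0 = c≡0
... | inj₂ x≤m = ⊥-elim (<⇒≱ m<x x≤m)

above-∉ : ∀ {m} l → All (_≤ m) l → All (suc m ≢_) l
above-∉ l = All.map λ {y} y≤m 1+m≡y → <⇒≱ (s≤s ≤-refl) (subst (_≤ _) (≡.sym 1+m≡y) y≤m)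

deleteOne-↭ : ∀ x l → 1 ≤ count x l → l ↭ x ∷ deleteOne x l
deleteOne-↭ x (y ∷ l) x∈l with x ≟ y
... | yes ≡.refl = ↭-refl
... | no  _    = ↭-trans (↭-prep y (deleteOne-↭ x l x∈l)) (↭-swap y x ↭-refl)

deleteOne-there : ∀ {x y} l → x ≢ y → deleteOne x (y ∷ l) ≡ y ∷ deleteOne x l
deleteOne-there {x} {y} l x≢y with x ≟ y
... | yes x≡y = ⊥-elim (x≢y x≡y)
... | no  _   = ≡.refl

deleteOne-All : ∀ {p} {Q : ℕ → Set p} x l → All Q l → All Q (deleteOne x l)
deleteOne-All x []      []       = []
deleteOne-All x (y ∷ l) (q ∷ qs) with x ≟ y
... | yes _ = qs
... | no  _ = q ∷ deleteOne-All x l qs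

quot-All : ∀ {p} {Q : ℕ → Set p} lam δ → All Q lam → All Q (quot lam δ)
quot-All lam []      qs = qs
quot-All lam (x ∷ δ) qs = deleteOne-All x (quot lam δ) (quot-All lam δ qs)

quot-keep : ∀ m lam δ → All (m ≢_) δ → quot (m ∷ lam) δ ≡ m ∷ quot lam δ
quot-keep m lam []      _            = ≡.refl
quot-keep m lam (x ∷ δ) (m≢x ∷ m∉δ) =
  ≡.trans (cong (deleteOne x) (quot-keep m lam δ m∉δ))
          (deleteOne-there (quot lam δ) (λ x≡m → m≢x (≡.sym x≡m)))

Divides-tail : ∀ {x δ lam} → Divides (x ∷ δ) lam → Divides δ lam
Divides-tail {x} {δ} (_ ∷ δ∣lam) = All.map (λ {y} c → ≤-trans (count-cons≤ y) c) δ∣lam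
  where
  count-cons≤ : ∀ y → count y δ ≤ count y (x ∷ δ)
  count-cons≤ y with y ≟ x
  ... | yes _ = n≤1+n _
  ... | no  _ = ≤-refl

quot-↭ : ∀ δ lam → Divides δ lam → lam ↭ δ ++ quot lam δ
quot-↭ []      lam _              = ↭-refl
quot-↭ (x ∷ δ) lam x∷δ∣lam@(x≤ ∷ _) =
  ↭-trans lam↭ (↭-trans (++⁺ˡ δ (deleteOne-↭ x rest x∈rest)) (↭-shift x δ (deleteOne x rest)))
  where
  rest : List ℕ
  rest = quot lam δ
  lam↭ : lam ↭ δ ++ rest
  lam↭ = quot-↭ δ lam (Divides-tail {x} {δ} {lam} x∷δ∣lam)
  x∈rest : 1 ≤ count x rest
  x∈rest = +-cancelˡ-≤ (count x δ) 1 (count x rest)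
    (subst₂ _≤_ (≡.trans (count-here x δ) (ℕₚ.+-comm 1 (count x δ)))
                (≡.trans (count-↭ x lam↭) (count-++ x δ rest)) x≤)

Divides⇒count≤ : ∀ {δ lam} → Divides δ lam → ∀ x → count x δ ≤ count x lam
Divides⇒count≤ {δ} {lam} δ∣lam x with count≡0-or x δ δ∣lam
... | inj₁ c≡0 = subst (_≤ _) (≡.sym c≡0) z≤n
... | inj₂ c≤  = c≤

¬Divides-above : ∀ {m} d δ lam → All (_≤ m) lam → m < d → ¬ Divides (d ∷ δ) lam
¬Divides-above d δ lam lam≤m m<d (d≤ ∷ _)
  with subst₂ _≤_ (count-here d δ) (count-above d lam lam≤m m<d) d≤
... | ()

Divides-skip⁻ : ∀ {m δ lam} → All (m ≢_) δ → Divides δ (m ∷ lam) → Divides δ lam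
Divides-skip⁻ {lam = lam} m∉δ δ∣ =
  All.zipWith (λ (m≢x , c≤) → subst (_ ≤_) (count-there lam (λ x≡m → m≢x (≡.sym x≡m))) c≤) (m∉δ , δ∣)

Divides-skip⁺ : ∀ {m δ lam} → All (m ≢_) δ → Divides δ lam → Divides δ (m ∷ lam)
Divides-skip⁺ {lam = lam} m∉δ δ∣ =
  All.zipWith (λ (m≢x , c≤) → subst (_ ≤_) (≡.sym (count-there lam (λ x≡m → m≢x (≡.sym x≡m)))) c≤) (m∉δ , δ∣)

Divides-cancel⁻ : ∀ {m δ lam} → Divides (m ∷ δ) (m ∷ lam) → Divides δ lam
Divides-cancel⁻ {m} {δ} {lam} (_ ∷ δ∣) = All.map (λ {x} → pred-count x) δ∣
  where
  pred-count : ∀ x → count x (m ∷ δ) ≤ count x (m ∷ lam) → count x δ ≤ count x lam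
  pred-count x c≤ with x ≟ m
  ... | yes _ = ≤-pred c≤
  ... | no  _ = c≤

Divides-cancel⁺ : ∀ {m δ lam} → Divides δ lam → Divides (m ∷ δ) (m ∷ lam)
Divides-cancel⁺ {m} {δ} {lam} δ∣ = All.universal (λ x → suc-count x (Divides⇒count≤ {δ} {lam} δ∣ x)) (m ∷ δ)
  where
  suc-count : ∀ x → count x δ ≤ count x lam → count x (m ∷ δ) ≤ count x (m ∷ lam)
  suc-count x c≤ with x ≟ m
  ... | yes _ = s≤s c≤
  ... | no  _ = c≤

++-cancelˡ-↭ : ∀ (xs : List ℕ) {ys zs} → xs ++ ys ↭ xs ++ zs → ys ↭ zs
++-cancelˡ-↭ []       p = p
++-cancelˡ-↭ (x ∷ xs) p = ++-cancelˡ-↭ xs (drop-∷ p)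

quot-cancel : ∀ m δ lam → Divides δ lam → quot (m ∷ lam) (m ∷ δ) ↭ quot lam δ
quot-cancel m δ lam δ∣lam = ++-cancelˡ-↭ δ (↭-trans (↭-sym lam↭) (quot-↭ δ lam δ∣lam))
  where
  lam↭ : lam ↭ δ ++ quot (m ∷ lam) (m ∷ δ)
  lam↭ = drop-∷ (quot-↭ (m ∷ δ) (m ∷ lam) (Divides-cancel⁺ {m} {δ} {lam} δ∣lam))

module Bracket {c ℓ′ : Level} (R : CommutativeRing c ℓ′) where
  open CommutativeRing R hiding (zero)
  open import Relation.Binary.Reasoning.Setoid setoid
  open import Algebra.Properties.Ring ring using (-1*x≈-x; -0#≈0#; -‿+-comm)
  open import Algebra.Properties.CommutativeSemigroup +-commutativeSemigroup using (interchange)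
  open import Tactic.RingSolver.NonReflective (fromCommutativeRing R (λ _ → nothing)) using (solve; _⊜_; _⊕_; ⊝_)

  C : Set c
  C = Carrier

  ∑ : ∀ {a} {A : Set a} → (A → C) → List A → C
  ∑ f xs = Σ R (map f xs)

  ∑-++ : ∀ {a} {A : Set a} (f : A → C) xs ys → ∑ f (xs ++ ys) ≈ ∑ f xs + ∑ f ys
  ∑-++ f []       ys = sym (+-identityˡ _)
  ∑-++ f (x ∷ xs) ys = trans (+-congˡ (∑-++ f xs ys)) (sym (+-assoc _ _ _))

  ∑-concatMap : ∀ {a b} {A : Set a} {B : Set b} (f : B → C) (g : A → List B) xs →
                ∑ f (concatMap g xs) ≈ ∑ (λ x → ∑ f (g x)) xs
  ∑-concatMap f g []       = refl
  ∑-concatMap f g (x ∷ xs) = trans (∑-++ f (g x) (concatMap g xs)) (+-congˡ (∑-concatMap f g xs))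

  ∑-map : ∀ {a b} {A : Set a} {B : Set b} (f : B → C) (g : A → B) xs → ∑ f (map g xs) ≡ ∑ (λ x → f (g x)) xs
  ∑-map f g []       = ≡.refl
  ∑-map f g (x ∷ xs) = cong (f (g x) +_) (∑-map f g xs)

  ∑-congᴬ : ∀ {a} {A : Set a} {f g : A → C} {xs} → All (λ x → f x ≈ g x) xs → ∑ f xs ≈ ∑ g xs
  ∑-congᴬ []         = refl
  ∑-congᴬ (e ∷ es) = +-cong e (∑-congᴬ es)

  ∑-cong : ∀ {a} {A : Set a} {f g : A → C} → (∀ x → f x ≈ g x) → ∀ xs → ∑ f xs ≈ ∑ g xs
  ∑-cong f≈g xs = ∑-congᴬ (All.universal f≈g xs)

  ∑-zeroᴬ : ∀ {a} {A : Set a} {f : A → C} {xs} → All (λ x → f x ≈ 0#) xs → ∑ f xs ≈ 0#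
  ∑-zeroᴬ []       = refl
  ∑-zeroᴬ (z ∷ zs) = trans (+-cong z (∑-zeroᴬ zs)) (+-identityˡ _)

  ∑-neg : ∀ {a} {A : Set a} (f : A → C) xs → ∑ (λ x → - f x) xs ≈ - ∑ f xs
  ∑-neg f []       = sym -0#≈0#
  ∑-neg f (x ∷ xs) = trans (+-congˡ (∑-neg f xs)) (-‿+-comm _ _)

  ∑-scale : ∀ {a} {A : Set a} (k : C) (f : A → C) xs → ∑ (λ x → k * f x) xs ≈ k * ∑ f xs
  ∑-scale k f []       = sym (zeroʳ k)
  ∑-scale k f (x ∷ xs) = trans (+-congˡ (∑-scale k f xs)) (sym (distribˡ k _ _))

  ∑-add : ∀ {a} {A : Set a} (f g : A → C) xs → ∑ (λ x → f x + g x) xs ≈ ∑ f xs + ∑ g xs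
  ∑-add f g []       = sym (+-identityˡ _)
  ∑-add f g (x ∷ xs) = trans (+-congˡ (∑-add f g xs)) (interchange _ _ _ _)

  ∑-swap : ∀ {a b} {A : Set a} {B : Set b} (f : A → B → C) xs ys →
           ∑ (λ x → ∑ (f x) ys) xs ≈ ∑ (λ y → ∑ (λ x → f x y) xs) ys
  ∑-swap f []       ys = sym (∑-zeroᴬ (All.universal (λ _ → refl) ys))
  ∑-swap f (x ∷ xs) ys = trans (+-congˡ (∑-swap f xs ys)) (sym (∑-add (f x) _ ys))

  ∑-scaleʳ : ∀ {a} {A : Set a} (f : A → C) k xs → ∑ (λ x → f x * k) xs ≈ ∑ f xs * k
  ∑-scaleʳ f k xs = trans (∑-cong (λ x → *-comm (f x) k) xs) (trans (∑-scale k f xs) (*-comm k _))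

  ∑-applyUpTo-suc : ∀ (f : ℕ → C) g t → ∑ f (applyUpTo g (suc t)) ≈ ∑ f (applyUpTo g t) + f (g t)
  ∑-applyUpTo-suc f g t = begin
      ∑ f (applyUpTo g (suc t))           ≡⟨ cong (∑ f) (≡.sym (applyUpTo-∷ʳ g t)) ⟩
      ∑ f (applyUpTo g t ++ [ g t ])      ≈⟨ ∑-++ f (applyUpTo g t) [ g t ] ⟩
      ∑ f (applyUpTo g t) + (f (g t) + 0#) ≈⟨ +-congˡ (+-identityʳ _) ⟩
      ∑ f (applyUpTo g t) + f (g t)       ∎

  ∑-upTo-cong : ∀ {f g : ℕ → C} N → (∀ i → i < N → f i ≈ g i) → ∑ f (upTo N) ≈ ∑ g (upTo N)
  ∑-upTo-cong N f≈g = ∑-congᴬ (applyUpTo⁺₁ (λ i → i) N (f≈g _))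

  when : ∀ {p} {Q : Set p} → Dec Q → C → C
  when (yes _) x = x
  when (no  _) x = 0#

  ∑-filter : ∀ {a p} {A : Set a} {Q : A → Set p} (Q? : ∀ x → Dec (Q x)) (f : A → C) xs →
             ∑ f (filter Q? xs) ≈ ∑ (λ x → when (Q? x) (f x)) xs
  ∑-filter Q? f []       = refl
  ∑-filter Q? f (x ∷ xs) with Q? x
  ... | yes _ = +-congˡ (∑-filter Q? f xs)
  ... | no  _ = trans (∑-filter Q? f xs) (sym (+-identityˡ _))

  when-cong : ∀ {p} {Q : Set p} (d : Dec Q) {x y} → x ≈ y → when d x ≈ when d y
  when-cong (yes _) x≈y = x≈y
  when-cong (no  _) _   = refl

  when-zero : ∀ {p} {Q : Set p} (d : Dec Q) → when d 0# ≈ 0#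
  when-zero (yes _) = refl
  when-zero (no  _) = refl

  when-neg : ∀ {p} {Q : Set p} (d : Dec Q) x → when d (- x) ≈ - when d x
  when-neg (yes _) x = refl
  when-neg (no  _) x = sym -0#≈0#

  when-scale : ∀ {p} {Q : Set p} (d : Dec Q) k x → when d (k * x) ≈ k * when d x
  when-scale (yes _) k x = refl
  when-scale (no  _) k x = sym (zeroʳ k)

  when-false : ∀ {p} {Q : Set p} (d : Dec Q) x → ¬ Q → when d x ≈ 0#
  when-false (yes q) x ¬q = ⊥-elim (¬q q)
  when-false (no  _) x ¬q = refl

  when-⇔ : ∀ {p q} {Q : Set p} {Q′ : Set q} (d : Dec Q) (d′ : Dec Q′) {x y} →
           (Q → Q′) → (Q′ → Q) → (Q′ → x ≈ y) → when d x ≈ when d′ y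
  when-⇔ (yes q) (yes q′) to from x≈y = x≈y q′
  when-⇔ (yes q) (no ¬q′) to from x≈y = ⊥-elim (¬q′ (to q))
  when-⇔ (no ¬q) (yes q′) to from x≈y = ⊥-elim (¬q (from q′))
  when-⇔ (no _)  (no _)   to from x≈y = refl

  -- Power series are coefficient sequences; shift s f is q^s · f.
  shift : ℕ → FPS R → FPS R
  shift zero    f k       = f k
  shift (suc s) f zero    = 0#
  shift (suc s) f (suc k) = shift s f k

  shift-≤ : ∀ s f k → s ≤ k → shift s f k ≡ f (k ∸ s)
  shift-≤ zero    f k       _       = ≡.refl
  shift-≤ (suc s) f (suc k) (s≤s s≤k) = shift-≤ s f k s≤k

  shift-< : ∀ s f k → k < s → shift s f k ≡ 0#
  shift-< (suc s) f zero    _         = ≡.refl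
  shift-< (suc s) f (suc k) (s≤s k<s) = shift-< s f k k<s

  shift-cong : ∀ {f g} → (∀ k → f k ≈ g k) → ∀ s k → shift s f k ≈ shift s g k
  shift-cong f≈g zero    k       = f≈g k
  shift-cong f≈g (suc s) zero    = refl
  shift-cong f≈g (suc s) (suc k) = shift-cong f≈g s k

  shift-zero : ∀ {f} → (∀ k → f k ≈ 0#) → ∀ s k → shift s f k ≈ 0#
  shift-zero f≈0 zero    k       = f≈0 k
  shift-zero f≈0 (suc s) zero    = refl
  shift-zero f≈0 (suc s) (suc k) = shift-zero f≈0 s k

  shift-scale : ∀ a f s k → shift s (λ j → a * f j) k ≈ a * shift s f k
  shift-scale a f zero    k       = refl
  shift-scale a f (suc s) zero    = sym (zeroʳ a)
  shift-scale a f (suc s) (suc k) = shift-scale a f s k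

  shift-neg : ∀ f s k → shift s (λ j → - f j) k ≈ - shift s f k
  shift-neg f zero    k       = refl
  shift-neg f (suc s) zero    = sym -0#≈0#
  shift-neg f (suc s) (suc k) = shift-neg f s k

  shift-sub : ∀ f g s k → shift s (λ j → f j + - g j) k ≈ shift s f k + - shift s g k
  shift-sub f g zero    k       = refl
  shift-sub f g (suc s) zero    = sym (trans (+-congˡ -0#≈0#) (+-identityʳ 0#))
  shift-sub f g (suc s) (suc k) = shift-sub f g s k

  shift-shift : ∀ s t f k → shift s (shift t f) k ≡ shift (s ℕ.+ t) f k
  shift-shift zero    t f k       = ≡.refl
  shift-shift (suc s) t f zero    = ≡.refl
  shift-shift (suc s) t f (suc k) = shift-shift s t f k

  shift-comm : ∀ s t f k → shift s (shift t f) k ≡ shift t (shift s f) k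
  shift-comm s t f k = ≡.trans (shift-shift s t f k)
    (≡.trans (cong (λ u → shift u f k) (ℕₚ.+-comm s t)) (≡.sym (shift-shift t s f k)))

  times1-q : ℕ → FPS R → FPS R
  times1-q a f k = f k + - shift (suc a) f k

  times1-q-cong : ∀ a {f g} → (∀ k → f k ≈ g k) → ∀ k → times1-q a f k ≈ times1-q a g k
  times1-q-cong a f≈g k = +-cong (f≈g k) (-‿cong (shift-cong f≈g (suc a) k))

  times1-q-comm : ∀ a b f k → times1-q a (times1-q b f) k ≈ times1-q b (times1-q a f) k
  times1-q-comm a b f k = begin
      (f k + - qᵇf k) + - shift (suc a) (λ j → f j + - qᵇf j) k
    ≈⟨ +-congˡ (-‿cong (shift-sub f qᵇf (suc a) k)) ⟩
      (f k + - qᵇf k) + - (qᵃf k + - shift (suc a) qᵇf k)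
    ≈⟨ swap-middle (f k) (qᵇf k) (qᵃf k) (shift (suc a) qᵇf k) ⟩
      (f k + - qᵃf k) + - (qᵇf k + - shift (suc a) qᵇf k)
    ≡⟨ cong (λ t → (f k + - qᵃf k) + - (qᵇf k + - t)) (shift-comm (suc a) (suc b) f k) ⟩
      (f k + - qᵃf k) + - (qᵇf k + - shift (suc b) qᵃf k)
    ≈⟨ +-congˡ (-‿cong (sym (shift-sub f qᵃf (suc b) k))) ⟩
      (f k + - qᵃf k) + - shift (suc b) (λ j → f j + - qᵃf j) k
    ∎
    where
    qᵃf qᵇf : FPS R
    qᵃf = shift (suc a) f
    qᵇf = shift (suc b) f
    swap-middle : ∀ x y z w → (x + - y) + - (z + - w) ≈ (x + - z) + - (y + - w)
    swap-middle = solve 4 (λ x y z w → ((x ⊕ (⊝ y)) ⊕ (⊝ (z ⊕ (⊝ w)))) ⊜ ((x ⊕ (⊝ z)) ⊕ (⊝ (y ⊕ (⊝ w))))) refl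

  coeff-addP : ∀ p p′ k → coeffP R (addP R p p′) k ≈ coeffP R p k + coeffP R p′ k
  coeff-addP []      p′       k       = sym (+-identityˡ _)
  coeff-addP (a ∷ p) []       k       = sym (+-identityʳ _)
  coeff-addP (a ∷ p) (b ∷ p′) zero    = refl
  coeff-addP (a ∷ p) (b ∷ p′) (suc k) = coeff-addP p p′ k

  coeff-scale : ∀ a p k → coeffP R (map (a *_) p) k ≈ a * coeffP R p k
  coeff-scale a []      k       = sym (zeroʳ a)
  coeff-scale a (b ∷ p) zero    = refl
  coeff-scale a (b ∷ p) (suc k) = coeff-scale a p k

  coeff-mulP-cons : ∀ a r p k → coeffP R (mulP R (a ∷ r) p) k ≈ a * coeffP R p k + shift 1 (coeffP R (mulP R r p)) k
  coeff-mulP-cons a r p k = trans (coeff-addP (map (a *_) p) _ k) (+-cong (coeff-scale a p k) (reflexive (lower-degree k)))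
    where
    lower-degree : ∀ k → coeffP R (0# ∷ mulP R r p) k ≡ shift 1 (coeffP R (mulP R r p)) k
    lower-degree zero    = ≡.refl
    lower-degree (suc k) = ≡.refl

  coeff-monomial : ∀ a b p k → coeffP R (mulP R (replicate a 0# ++ [ b ]) p) k ≈ b * shift a (coeffP R p) k
  coeff-monomial zero b p k = begin
      coeffP R (mulP R [ b ] p) k                 ≈⟨ coeff-mulP-cons b [] p k ⟩
      b * coeffP R p k + shift 1 (coeffP R []) k  ≈⟨ +-congˡ (shift-zero (λ _ → refl) 1 k) ⟩
      b * coeffP R p k + 0#                       ≈⟨ +-identityʳ _ ⟩
      b * coeffP R p k                            ∎
  coeff-monomial (suc a) b p k = begin
      coeffP R (mulP R (0# ∷ replicate a 0# ++ [ b ]) p) k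
    ≈⟨ coeff-mulP-cons 0# (replicate a 0# ++ [ b ]) p k ⟩
      0# * coeffP R p k + shift 1 (coeffP R (mulP R (replicate a 0# ++ [ b ]) p)) k
    ≈⟨ +-cong (zeroˡ _) (shift-cong (coeff-monomial a b p) 1 k) ⟩
      0# + shift 1 (λ j → b * shift a (coeffP R p) j) k
    ≈⟨ +-identityˡ _ ⟩
      shift 1 (λ j → b * shift a (coeffP R p) j) k
    ≈⟨ shift-scale b (shift a (coeffP R p)) 1 k ⟩
      b * shift 1 (shift a (coeffP R p)) k
    ≡⟨ cong (b *_) (shift-shift 1 a (coeffP R p) k) ⟩
      b * shift (suc a) (coeffP R p) k
    ∎

  coeff-oneMinusQ : ∀ a p k → coeffP R (mulP R (oneMinusQ R a) p) k ≈ times1-q a (coeffP R p) k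
  coeff-oneMinusQ a p k = begin
      coeffP R (mulP R (oneMinusQ R a) p) k
    ≈⟨ coeff-mulP-cons 1# (replicate a 0# ++ [ - 1# ]) p k ⟩
      1# * coeffP R p k + shift 1 (coeffP R (mulP R (replicate a 0# ++ [ - 1# ]) p)) k
    ≈⟨ +-cong (*-identityˡ _) (shift-cong (coeff-monomial a (- 1#) p) 1 k) ⟩
      coeffP R p k + shift 1 (λ j → - 1# * shift a (coeffP R p) j) k
    ≈⟨ +-congˡ (shift-scale (- 1#) (shift a (coeffP R p)) 1 k) ⟩
      coeffP R p k + - 1# * shift 1 (shift a (coeffP R p)) k
    ≈⟨ +-congˡ (-1*x≈-x _) ⟩
      coeffP R p k + - shift 1 (shift a (coeffP R p)) k
    ≡⟨ cong (λ t → coeffP R p k + - t) (shift-shift 1 a (coeffP R p) k) ⟩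
      coeffP R p k + - shift (suc a) (coeffP R p) k
    ∎

  euler : ℕ → FPS R
  euler m = foldr times1-q (coeffP R [ 1# ]) (upTo m)

  coeff-eulerPoly : ∀ m k → coeffP R (eulerPoly R m) k ≈ euler m k
  coeff-eulerPoly m k = begin
      coeffP R (foldr (mulP R) [ 1# ] (applyUpTo (oneMinusQ R) m)) k
    ≡⟨ cong (λ l → coeffP R (foldr (mulP R) [ 1# ] l) k) (≡.sym (map-applyUpTo (λ i → i) (oneMinusQ R) m)) ⟩
      coeffP R (foldr (mulP R) [ 1# ] (map (oneMinusQ R) (upTo m))) k
    ≈⟨ coeff-product (upTo m) k ⟩
      euler m k
    ∎
    where
    coeff-product : ∀ as k → coeffP R (foldr (mulP R) [ 1# ] (map (oneMinusQ R) as)) k ≈ foldr times1-q (coeffP R [ 1# ]) as k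
    coeff-product []       k = refl
    coeff-product (a ∷ as) k = trans (coeff-oneMinusQ a (foldr (mulP R) [ 1# ] (map (oneMinusQ R) as)) k) (times1-q-cong a (coeff-product as) k)

  -- The factors commute, so the newest factor 1 - q^(m+1) may be applied last.
  euler-suc : ∀ m k → euler (suc m) k ≈ times1-q m (euler m) k
  euler-suc m k = begin
      foldr times1-q (coeffP R [ 1# ]) (upTo (suc m)) k
    ≡⟨ cong (λ l → foldr times1-q (coeffP R [ 1# ]) l k) (≡.sym (applyUpTo-∷ʳ (λ i → i) m)) ⟩
      foldr times1-q (coeffP R [ 1# ]) (upTo m ++ [ m ]) k
    ≈⟨ apply-last (upTo m) k ⟩
      times1-q m (euler m) k
    ∎
    where
    apply-last : ∀ as k → foldr times1-q (coeffP R [ 1# ]) (as ++ [ m ]) k ≈ times1-q m (foldr times1-q (coeffP R [ 1# ]) as) k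
    apply-last []       k = refl
    apply-last (a ∷ as) k = trans (times1-q-cong a (apply-last as) k) (times1-q-comm a m _ k)

  SP : (List ℕ → C) → ℕ → ℕ → C
  SP g n m = ∑ g (P n m)

  leading : (List ℕ → C) → ℕ → ℕ → C
  leading g j k = SP (λ ν → g (k ∷ ν)) j k

  byLargestPart : (List ℕ → C) → ℕ → ℕ → C
  byLargestPart g n k = leading g (suc n ∸ k) k

  SP-byLargestPart : ∀ g n m → SP g (suc n) m ≈ ∑ (byLargestPart g n) (applyUpTo suc (m ⊓ suc n))
  SP-byLargestPart g n m = begin
      ∑ g (concatMap (λ k → map (k ∷_) (partitionsF n (suc n ∸ k) k)) ks)
    ≈⟨ ∑-concatMap g (λ k → map (k ∷_) (partitionsF n (suc n ∸ k) k)) ks ⟩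
      ∑ (λ k → ∑ g (map (k ∷_) (partitionsF n (suc n ∸ k) k))) ks
    ≈⟨ ∑-congᴬ (applyUpTo⁺₂ suc (m ⊓ suc n) λ i → reflexive (drop-fuel i)) ⟩
      ∑ (byLargestPart g n) ks
    ∎
    where
    ks : List ℕ
    ks = applyUpTo suc (m ⊓ suc n)
    drop-fuel : ∀ i → ∑ g (map (suc i ∷_) (partitionsF n (n ∸ i) (suc i))) ≡ byLargestPart g n (suc i)
    drop-fuel i = ≡.trans (∑-map g (suc i ∷_) (partitionsF n (n ∸ i) (suc i)))
      (cong (∑ (λ ν → g (suc i ∷ ν))) (partitionsF-fuel n (n ∸ i) (n ∸ i) (suc i) (m∸n≤m n i) ≤-refl))

  SP-split : ∀ g m n → SP g n (suc m) ≈ SP g n m + shift (suc m) (λ j → leading g j (suc m)) n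
  SP-split g m zero    = sym (+-identityʳ _)
  SP-split g m (suc n) with m ≤? n
  ... | yes m≤n = begin
      SP g (suc n) (suc m)
    ≈⟨ SP-byLargestPart g n (suc m) ⟩
      ∑ L (applyUpTo suc (suc m ⊓ suc n))
    ≡⟨ cong (λ t → ∑ L (applyUpTo suc (suc t))) (m≤n⇒m⊓n≡m m≤n) ⟩
      ∑ L (applyUpTo suc (suc m))
    ≈⟨ ∑-applyUpTo-suc L suc m ⟩
      ∑ L (applyUpTo suc m) + L (suc m)
    ≡⟨ ≡.cong₂ _+_ (cong (λ t → ∑ L (applyUpTo suc t)) (≡.sym (m≤n⇒m⊓n≡m (m≤n⇒m≤1+n m≤n))))
                   (≡.sym (shift-≤ (suc m) (λ j → leading g j (suc m)) (suc n) (s≤s m≤n))) ⟩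
      ∑ L (applyUpTo suc (m ⊓ suc n)) + shift (suc m) (λ j → leading g j (suc m)) (suc n)
    ≈⟨ +-congʳ (sym (SP-byLargestPart g n m)) ⟩
      SP g (suc n) m + shift (suc m) (λ j → leading g j (suc m)) (suc n)
    ∎
    where
    L : ℕ → C
    L = byLargestPart g n
  ... | no m≰n = begin
      SP g (suc n) (suc m)
    ≈⟨ SP-byLargestPart g n (suc m) ⟩
      ∑ L (applyUpTo suc (suc m ⊓ suc n))
    ≡⟨ cong (λ t → ∑ L (applyUpTo suc t)) (≡.trans (m≥n⇒m⊓n≡n (s≤s (<⇒≤ n<m))) (≡.sym (m≥n⇒m⊓n≡n n<m))) ⟩
      ∑ L (applyUpTo suc (m ⊓ suc n))
    ≈⟨ sym (SP-byLargestPart g n m) ⟩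
      SP g (suc n) m
    ≈⟨ sym (+-identityʳ _) ⟩
      SP g (suc n) m + 0#
    ≡⟨ cong (SP g (suc n) m +_) (≡.sym (shift-< (suc m) (λ j → leading g j (suc m)) (suc n) (s≤s n<m))) ⟩
      SP g (suc n) m + shift (suc m) (λ j → leading g j (suc m)) (suc n)
    ∎
    where
    n<m : n < m
    n<m = ≰⇒> m≰n
    L : ℕ → C
    L = byLargestPart g n

  SP-rec : ∀ h m → (∀ ν → All (_≤ m) ν → h (suc m ∷ ν) ≈ - h ν) → (∀ ν → h (suc m ∷ suc m ∷ ν) ≈ 0#) →
           ∀ n → SP h n (suc m) ≈ times1-q m (λ j → SP h j m) n
  SP-rec h m flip kill n = begin
      SP h n (suc m)                                          ≈⟨ SP-split h m n ⟩
      SP h n m + shift (suc m) (λ j → leading h j (suc m)) n  ≈⟨ +-congˡ (shift-cong leading≈ (suc m) n) ⟩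
      SP h n m + shift (suc m) (λ j → - SP h j m) n           ≈⟨ +-congˡ (shift-neg (λ j → SP h j m) (suc m) n) ⟩
      SP h n m + - shift (suc m) (λ j → SP h j m) n           ∎
    where
    h′ : List ℕ → C
    h′ ν = h (suc m ∷ ν)
    flipped : ∀ j → SP h′ j m ≈ - SP h j m
    flipped j = trans (∑-congᴬ (All.map (λ {ν} ν∈ → flip ν (IsPart⇒All≤ (proj₁ ν∈))) (P-sound j m))) (∑-neg h (P j m))
    repeated : ∀ i → leading h′ i (suc m) ≈ 0#
    repeated i = ∑-zeroᴬ (All.universal kill (P i (suc m)))
    leading≈ : ∀ j → leading h j (suc m) ≈ - SP h j m
    leading≈ j = begin
        SP h′ j (suc m)                                            ≈⟨ SP-split h′ m j ⟩
        SP h′ j m + shift (suc m) (λ i → leading h′ i (suc m)) j  ≈⟨ +-cong (flipped j) (shift-zero repeated (suc m) j) ⟩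
        - SP h j m + 0#                                           ≈⟨ +-identityʳ _ ⟩
        - SP h j m                                                ∎

  μ-unique : ∀ l → Unique l → μP R l ≈ sign R (length l)
  μ-unique l u with unique? l
  ... | yes _ = refl
  ... | no ¬u = ⊥-elim (¬u u)

  μ-repeated : ∀ l → ¬ Unique l → μP R l ≈ 0#
  μ-repeated l ¬u with unique? l
  ... | yes u = ⊥-elim (¬u u)
  ... | no  _ = refl

  μ-cons : ∀ x ν → All (x ≢_) ν → μP R (x ∷ ν) ≈ - μP R ν
  μ-cons x ν x∉ν = by-cases (unique? ν)
    where
    by-cases : Dec (Unique ν) → μP R (x ∷ ν) ≈ - μP R ν
    by-cases (yes u) = trans (μ-unique (x ∷ ν) (x∉ν ∷ u)) (-‿cong (sym (μ-unique ν u)))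
    by-cases (no ¬u) = trans (μ-repeated (x ∷ ν) (λ { (_ ∷ u) → ¬u u }))
                             (sym (trans (-‿cong (μ-repeated ν ¬u)) -0#≈0#))

  μ-dup : ∀ x ν → μP R (x ∷ x ∷ ν) ≈ 0#
  μ-dup x ν = μ-repeated (x ∷ x ∷ ν) (λ { ((x≢x ∷ _) ∷ _) → x≢x ≡.refl })

  μ-↭ : ∀ {l l′} → l ↭ l′ → μP R l ≈ μP R l′
  μ-↭ {l} {l′} l↭l′ = by-cases (unique? l)
    where
    by-cases : Dec (Unique l) → μP R l ≈ μP R l′
    by-cases (yes u) = trans (μ-unique l u) (trans (reflexive (cong (sign R) (↭-length l↭l′)))
                         (sym (μ-unique l′ (Unique-resp-↭ (↭⇒↭ₛ l↭l′) u))))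
    by-cases (no ¬u) = trans (μ-repeated l ¬u)
                         (sym (μ-repeated l′ (λ u′ → ¬u (Unique-resp-↭ (↭⇒↭ₛ (↭-sym l↭l′)) u′))))

  μQuot : List ℕ → List ℕ → C
  μQuot δ lam = when (divides? δ lam) (μP R (quot lam δ))

  D : List ℕ → ℕ → ℕ → C
  D δ j m = SP (μQuot δ) j m

  D-rec : ∀ m δ → All (_≤ m) δ → ∀ n → D δ n (suc m) ≈ times1-q m (λ j → D δ j m) n
  D-rec m δ δ≤m = SP-rec (μQuot δ) m flip kill
    where
    m+1∉δ : All (suc m ≢_) δ
    m+1∉δ = above-∉ δ δ≤m
    flip : ∀ ν → All (_≤ m) ν → μQuot δ (suc m ∷ ν) ≈ - μQuot δ ν
    flip ν ν≤m = trans
      (when-⇔ (divides? δ (suc m ∷ ν)) (divides? δ ν) (Divides-skip⁻ m+1∉δ) (Divides-skip⁺ m+1∉δ) λ _ → begin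
         μP R (quot (suc m ∷ ν) δ)  ≡⟨ cong (μP R) (quot-keep (suc m) ν δ m+1∉δ) ⟩
         μP R (suc m ∷ quot ν δ)    ≈⟨ μ-cons (suc m) (quot ν δ) (above-∉ (quot ν δ) (quot-All ν δ ν≤m)) ⟩
         - μP R (quot ν δ)          ∎)
      (when-neg (divides? δ ν) (μP R (quot ν δ)))
    kill : ∀ ν → μQuot δ (suc m ∷ suc m ∷ ν) ≈ 0#
    kill ν = trans
      (when-cong (divides? δ (suc m ∷ suc m ∷ ν)) (begin
         μP R (quot (suc m ∷ suc m ∷ ν) δ)  ≡⟨ cong (μP R) (≡.trans (quot-keep (suc m) (suc m ∷ ν) δ m+1∉δ)
                                                                (cong (suc m ∷_) (quot-keep (suc m) ν δ m+1∉δ))) ⟩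
         μP R (suc m ∷ suc m ∷ quot ν δ)    ≈⟨ μ-dup (suc m) (quot ν δ) ⟩
         0#                                 ∎))
      (when-zero (divides? δ (suc m ∷ suc m ∷ ν)))

  -- The main identity D δ j m = [q^j] q^|δ| Σ_i D [] i m q^i, by induction on the parts of δ:
  -- a largest part m+1 of δ is cancelled against the largest part of λ ...
  D-top : ∀ m δ → (∀ j → D δ j (suc m) ≈ shift (size δ) (λ i → D [] i (suc m)) j) →
          ∀ j → D (suc m ∷ δ) j (suc m) ≈ shift (size (suc m ∷ δ)) (λ i → D [] i (suc m)) j
  D-top m δ D-δ j = begin
      D δ₁ j (suc m)
    ≈⟨ SP-split (μQuot δ₁) m j ⟩
      D δ₁ j m + shift (suc m) (λ i → leading (μQuot δ₁) i (suc m)) j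
    ≈⟨ +-cong none-below (shift-cong cancel-top (suc m) j) ⟩
      0# + shift (suc m) (λ i → D δ i (suc m)) j
    ≈⟨ +-identityˡ _ ⟩
      shift (suc m) (λ i → D δ i (suc m)) j
    ≈⟨ shift-cong D-δ (suc m) j ⟩
      shift (suc m) (shift (size δ) (λ i → D [] i (suc m))) j
    ≡⟨ shift-shift (suc m) (size δ) (λ i → D [] i (suc m)) j ⟩
      shift (suc m ℕ.+ size δ) (λ i → D [] i (suc m)) j
    ∎
    where
    δ₁ : List ℕ
    δ₁ = suc m ∷ δ
    none-below : D δ₁ j m ≈ 0#
    none-below = ∑-zeroᴬ (All.map (λ {lam} lam∈ → when-false (divides? δ₁ lam) _
                   (¬Divides-above (suc m) δ lam (IsPart⇒All≤ (proj₁ lam∈)) ≤-refl)) (P-sound j m))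
    cancel-top : ∀ i → leading (μQuot δ₁) i (suc m) ≈ D δ i (suc m)
    cancel-top i = ∑-cong (λ ν → when-⇔ (divides? δ₁ (suc m ∷ ν)) (divides? δ ν)
                     Divides-cancel⁻ Divides-cancel⁺ (λ δ∣ν → μ-↭ (quot-cancel (suc m) δ ν δ∣ν))) (P i (suc m))

  -- ... while for δ with parts ≤ m both sides obey the recursion of D-rec in m.
  D-below : ∀ m δ → All (_≤ m) δ → (∀ j → D δ j m ≈ shift (size δ) (λ i → D [] i m) j) →
            ∀ j → D δ j (suc m) ≈ shift (size δ) (λ i → D [] i (suc m)) j
  D-below m δ δ≤m D-δ j = begin
      D δ j (suc m)
    ≈⟨ D-rec m δ δ≤m j ⟩
      D δ j m + - shift (suc m) (λ i → D δ i m) j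
    ≈⟨ +-cong (D-δ j) (-‿cong (shift-cong D-δ (suc m) j)) ⟩
      shift s Dm j + - shift (suc m) (shift s Dm) j
    ≡⟨ cong (λ t → shift s Dm j + - t) (shift-comm (suc m) s Dm j) ⟩
      shift s Dm j + - shift s (shift (suc m) Dm) j
    ≈⟨ sym (shift-sub Dm (shift (suc m) Dm) s j) ⟩
      shift s (times1-q m Dm) j
    ≈⟨ shift-cong (λ i → sym (D-rec m [] [] i)) s j ⟩
      shift s (λ i → D [] i (suc m)) j
    ∎
    where
    s : ℕ
    s = size δ
    Dm : FPS R
    Dm i = D [] i m

  ShiftIdentity : ℕ → Set ℓ′
  ShiftIdentity m = ∀ {δ} → IsPart m δ → ∀ j → D δ j m ≈ shift (size δ) (λ i → D [] i m) j

  D-shift-suc : ∀ m → ShiftIdentity m → ShiftIdentity (suc m)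
  D-shift-suc m D-shift-m nil = λ j → refl
  D-shift-suc m D-shift-m (cons {d = d} {δ = δ} 1≤d d≤1+m δ-part) with d ≟ suc m
  ... | yes ≡.refl = D-top m δ (D-shift-suc m D-shift-m δ-part)
  ... | no  d≢1+m  = D-below m (d ∷ δ) (IsPart⇒All≤ d∷δ-part) (D-shift-m d∷δ-part)
    where
    d∷δ-part : IsPart m (d ∷ δ)
    d∷δ-part = cons 1≤d (≤-pred (≤∧≢⇒< d≤1+m d≢1+m)) δ-part

  D-shift : ∀ m → ShiftIdentity m
  D-shift zero    nil                 = λ j → refl
  D-shift zero    (cons (s≤s _) () _)
  D-shift (suc m) = D-shift-suc m (D-shift m)

  euler≈D : ∀ m n → euler m n ≈ D [] n m
  euler≈D zero    zero    = sym (+-identityʳ 1#)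
  euler≈D zero    (suc n) = refl
  euler≈D (suc m) n = begin
      euler (suc m) n               ≈⟨ euler-suc m n ⟩
      times1-q m (euler m) n        ≈⟨ times1-q-cong m (euler≈D m) n ⟩
      times1-q m (λ j → D [] j m) n ≈⟨ sym (D-rec m [] [] n) ⟩
      D [] n (suc m)                ∎

  qPoch≈D : ∀ k → qPoch R k ≈ D [] k k
  qPoch≈D k = trans (coeff-eulerPoly k k) (euler≈D k k)

  ∑-reflect : ∀ n (f : ℕ → C) → ∑ f (upTo (suc n)) ≈ ∑ (λ k → f (n ∸ k)) (upTo (suc n))
  ∑-reflect zero    f = refl
  ∑-reflect (suc n) f = begin
      f 0 + ∑ f (applyUpTo suc (suc n))
    ≡⟨ cong (λ l → f 0 + ∑ f l) (≡.sym (map-applyUpTo (λ i → i) suc (suc n))) ⟩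
      f 0 + ∑ f (map suc (upTo (suc n)))
    ≡⟨ cong (f 0 +_) (∑-map f suc (upTo (suc n))) ⟩
      f 0 + ∑ (λ k → f (suc k)) (upTo (suc n))
    ≈⟨ +-congˡ (∑-reflect n (λ k → f (suc k))) ⟩
      f 0 + ∑ (λ k → f (suc (n ∸ k))) (upTo (suc n))
    ≈⟨ +-congˡ (∑-upTo-cong (suc n) λ i i≤n → reflexive (cong f (≡.sym (+-∸-assoc 1 (≤-pred i≤n))))) ⟩
      f 0 + ∑ (λ k → f (suc n ∸ k)) (upTo (suc n))
    ≈⟨ +-comm _ _ ⟩
      ∑ (λ k → f (suc n ∸ k)) (upTo (suc n)) + f 0
    ≡⟨ cong (λ i → ∑ (λ k → f (suc n ∸ k)) (upTo (suc n)) + f i) (≡.sym (n∸n≡0 n)) ⟩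
      ∑ (λ k → f (suc n ∸ k)) (upTo (suc n)) + f (suc n ∸ suc n)
    ≈⟨ sym (∑-applyUpTo-suc (λ k → f (suc n ∸ k)) (λ i → i) (suc n)) ⟩
      ∑ (λ k → f (suc n ∸ k)) (upTo (suc (suc n)))
    ∎

  ⋆-comm : ∀ a b n → _⋆_ R a b n ≈ _⋆_ R b a n
  ⋆-comm a b n = begin
      ∑ (λ k → a k * b (n ∸ k)) (upTo (suc n))
    ≈⟨ ∑-reflect n (λ k → a k * b (n ∸ k)) ⟩
      ∑ (λ k → a (n ∸ k) * b (n ∸ (n ∸ k))) (upTo (suc n))
    ≈⟨ ∑-upTo-cong (suc n) (λ k k≤n → trans (*-comm _ _) (*-congʳ (reflexive (cong b (m∸[m∸n]≡n (≤-pred k≤n)))))) ⟩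
      ∑ (λ k → b k * a (n ∸ k)) (upTo (suc n))
    ∎

  ∑-μQuot : ∀ n k δ → k ≤ n → PartitionOf k k δ → ∑ (μQuot δ) (P n n) ≈ qPoch R (n ∸ k)
  ∑-μQuot n k δ k≤n (δ-part , |δ|≡k) = begin
      D δ n n                            ≈⟨ D-shift n (IsPart-mono k≤n δ-part) n ⟩
      shift (size δ) (λ i → D [] i n) n  ≡⟨ cong (λ s → shift s (λ i → D [] i n) n) |δ|≡k ⟩
      shift k (λ i → D [] i n) n         ≡⟨ shift-≤ k (λ i → D [] i n) n k≤n ⟩
      D [] (n ∸ k) n                     ≡⟨ cong (∑ (μQuot [])) (P-saturated (n ∸ k) n (m∸n≤m n k)) ⟩
      D [] (n ∸ k) (n ∸ k)               ≈⟨ sym (qPoch≈D (n ∸ k)) ⟩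
      qPoch R (n ∸ k)                    ∎

  -- The summand of the double sum Σ_λ Σ_{δ ∣ λ} F(δ) μ_P(λ/δ), extended by 0 to all δ.
  term : (List ℕ → C) → List ℕ → List ℕ → C
  term F lam δ = F δ * μQuot δ lam

  column : ∀ F n k → k < suc n →
           seriesP R F k * qPoch R (n ∸ k) ≈ ∑ (λ δ → ∑ (λ lam → term F lam δ) (P n n)) (P k k)
  column F n k k<1+n = begin
      ∑ F (P k k) * qPoch R (n ∸ k)
    ≈⟨ sym (∑-scaleʳ F (qPoch R (n ∸ k)) (P k k)) ⟩
      ∑ (λ δ → F δ * qPoch R (n ∸ k)) (P k k)
    ≈⟨ ∑-congᴬ (All.map (λ {δ} δ∈ → *-congˡ (sym (∑-μQuot n k δ (≤-pred k<1+n) δ∈))) (P-sound k k)) ⟩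
      ∑ (λ δ → F δ * ∑ (μQuot δ) (P n n)) (P k k)
    ≈⟨ ∑-cong (λ δ → sym (∑-scale (F δ) (μQuot δ) (P n n))) (P k k) ⟩
      ∑ (λ δ → ∑ (λ lam → term F lam δ) (P n n)) (P k k)
    ∎

  -- f(λ) as a sum over all partitions δ of size ≤ |λ|: the divisors of λ are the δ ∣ λ among them.
  fOf-expand : ∀ F n lam → size lam ≡ n → fOf R F lam ≈ ∑ (λ k → ∑ (term F lam) (P k k)) (upTo (suc n))
  fOf-expand F n lam |λ|≡n = begin
      ∑ (λ δ → F δ * μP R (quot lam δ)) (concatMap (λ k → filter (λ δ → divides? δ lam) (P k k)) ks)
    ≈⟨ ∑-concatMap (λ δ → F δ * μP R (quot lam δ)) (λ k → filter (λ δ → divides? δ lam) (P k k)) ks ⟩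
      ∑ (λ k → ∑ (λ δ → F δ * μP R (quot lam δ)) (filter (λ δ → divides? δ lam) (P k k))) ks
    ≈⟨ ∑-cong (λ k → trans (∑-filter (λ δ → divides? δ lam) (λ δ → F δ * μP R (quot lam δ)) (P k k))
                           (∑-cong (λ δ → when-scale (divides? δ lam) (F δ) (μP R (quot lam δ))) (P k k))) ks ⟩
      ∑ (λ k → ∑ (term F lam) (P k k)) ks
    ≡⟨ cong (λ t → ∑ (λ k → ∑ (term F lam) (P k k)) (upTo (suc t))) |λ|≡n ⟩
      ∑ (λ k → ∑ (term F lam) (P k k)) (upTo (suc n))
    ∎
    where
    ks : List ℕ
    ks = upTo (suc (size lam))

  fOf-series : ∀ F n → seriesP R (fOf R F) n ≈ ∑ (λ lam → ∑ (λ k → ∑ (term F lam) (P k k)) (upTo (suc n))) (P n n)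
  fOf-series F n = ∑-congᴬ (All.map (λ {lam} lam∈ → fOf-expand F n lam (proj₂ lam∈)) (P-sound n n))

theorem3p18 : ∀ {c ℓ′ : Level} (R : CommutativeRing c ℓ′)
                (F : List ℕ → CommutativeRing.Carrier R) (n : ℕ) →
                CommutativeRing._≈_ R (qBracket R F n) (seriesP R (fOf R F) n)
theorem3p18 R F n = begin
    qBracket R F n
  ≈⟨ ⋆-comm (qPoch R) (seriesP R F) n ⟩
    ∑ (λ k → seriesP R F k * qPoch R (n ∸ k)) (upTo (suc n))
  ≈⟨ ∑-upTo-cong (suc n) (column F n) ⟩
    ∑ (λ k → ∑ (λ δ → ∑ (λ lam → term F lam δ) (P n n)) (P k k)) (upTo (suc n))
  ≈⟨ ∑-cong (λ k → ∑-swap (λ δ lam → term F lam δ) (P k k) (P n n)) (upTo (suc n)) ⟩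
    ∑ (λ k → ∑ (λ lam → ∑ (term F lam) (P k k)) (P n n)) (upTo (suc n))
  ≈⟨ ∑-swap (λ k lam → ∑ (term F lam) (P k k)) (upTo (suc n)) (P n n) ⟩
    ∑ (λ lam → ∑ (λ k → ∑ (term F lam) (P k k)) (upTo (suc n))) (P n n)
  ≈⟨ sym (fOf-series F n) ⟩
    seriesP R (fOf R F) n
  ∎
  where
  open CommutativeRing R using (setoid; sym; _*_)
  open import Relation.Binary.Reasoning.Setoid setoid
  open Bracket R
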